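{- Let $\ell=\ell(n)$ satisfy $3\log n\le\ell<n$, and let $G=(V,E)$ be an $n$-vertex graph in which every pair of vertices has at least $\ell$ common neighbours. Then $G$ admits a strong $d$-rigid partition for $d=\ell/(3\log n)$.
   Context: For $A,B\subseteq V$, $G[A,B]$ is the graph on $A\cup B$ with the edges of $G$ having one endpoint in $A$ and the other in $B$. A strong $d$-rigid partition of $G$ is a partition $V=V_1\cup\dots\cup V_d$ into nonempty sets such that $G[V_i,V_j]$ is connected for all $1\le i\le j\le d$. Logarithms are natural; the paper omits floor and ceiling signs, so $d$ is understood as rounded to an integer. -}

module Defs where

open import Data.Nat using (ℕ; zero; suc; _+_; _*_; _^_; _≤_; _<_; _!)

open import Data.Bool using (Bool; true; false; _∧_; T)
open import Data.Fin using (Fin)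
open import Data.List using (List; length; filterᵇ; allFin)
open import Data.Product using (Σ; ∃; _×_)
open import Data.Sum using (_⊎_)
open import Relation.Nullary using (¬_)
open import Relation.Binary.PropositionalEquality using (_≡_)
open import Relation.Binary.Construct.Closure.ReflexiveTransitive using (Star)
open import Function.Definitions using (Surjective)

-- Comparison with e^ℓ (natural exponential), without real numbers.
-- ExpNum ℓ k = k! * Σ_{i=0}^{k} ℓ^i / i!   (a natural number), so that
-- ExpNum ℓ k / k! is the k-th partial sum of the series of e^ℓ.
ExpNum : ℕ → ℕ → ℕ
ExpNum ℓ zero    = 1
ExpNum ℓ (suc k) = suc k * ExpNum ℓ k + ℓ ^ suc k

-- x ≤ e^ℓ  (equivalently  log x ≤ ℓ  for x ≥ 1, log natural):
-- some partial sum of the exponential series is ≥ x.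
infix 4 _≤exp_
_≤exp_ : ℕ → ℕ → Set
x ≤exp ℓ = ∃ λ k → x * (k !) ≤ ExpNum ℓ k

record Graph (n : ℕ) : Set where
  field
    adj   : Fin n → Fin n → Bool
    sym   : ∀ u v → adj u v ≡ adj v u
    irrefl : ∀ v → adj v v ≡ false
open Graph public

commonNbrs : ∀ {n} → Graph n → Fin n → Fin n → ℕ
commonNbrs G u v = length (filterᵇ (λ w → adj G u w ∧ adj G w v) (allFin _))

BipEdge : ∀ {n} → Graph n → (Fin n → Set) → (Fin n → Set) → Fin n → Fin n → Set
BipEdge G A B x y = T (adj G x y) × ((A x × B y) ⊎ (B x × A y))

ConnectedBetween : ∀ {n} → Graph n → (Fin n → Set) → (Fin n → Set) → Set
ConnectedBetween {n} G A B =
  ∀ (x y : Fin n) → (A x ⊎ B x) → (A y ⊎ B y) → Star (BipEdge G A B) x y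

-- Strong d-rigid partition: a map part : V → Fin d (V_i = part⁻¹(i)),
-- surjective (all parts nonempty), with G[V_i,V_j] connected for all i ≤ j
-- (we require it for all i, j; G[A,B] = G[B,A]).
StrongRigidPartition : ∀ {n} → Graph n → ℕ → Set
StrongRigidPartition {n} G d =
  Σ (Fin n → Fin d) λ part →
    Surjective _≡_ _≡_ part ×
    (∀ (i j : Fin d) →
       ConnectedBetween G (λ v → part v ≡ i) (λ v → part v ≡ j))

-- Colour the vertices uniformly at random with d colours.  For distinct u, v and a colour c,
-- the probability that no common neighbour of u and v gets colour c is at most (1 − 1/d)^ℓ,
-- and n² d (1 − 1/d)^ℓ < 1 because (1 − 1/d)^ℓ ≤ e^(−ℓ/d) ≤ n^(−3) and d < n.  So some
-- colouring shows every colour in every common neighbourhood N(u) ∩ N(v); then any two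
-- vertices of V_i ∪ V_j are joined in G[V_i, V_j] by a walk of length at most 3.
-- The probability is replaced by a count over all d^n colourings, and e^(−1/d) ≥ 1 − 1/d by
-- an inequality between partial sums of the exponential series.  Only n^(3d) ≤ e^ℓ is used;
-- the maximality of d merely excludes d = 0 and ℓ = 0.
module Submission where

open import Defs
open import Data.Nat using (ℕ; suc; _*_; _^_; _≤_; _<_)
open import Data.Fin using (Fin)
open import Relation.Nullary using (¬_)
open import Relation.Binary.PropositionalEquality using (_≢_)

open import Data.Nat using (zero; _+_; _!; NonZero; >-nonZero; z≤n; s≤s)
open import Data.Nat.Properties hiding (_≟_)
open import Data.Nat.Tactic.RingSolver using (solve-∀)
open import Data.Bool using (Bool; true; false; _∧_; T; if_then_else_)
open import Data.Bool.Properties using (T-∧)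
open import Data.Fin using (zero; suc; _≟_)
open import Data.Vec.Functional using ([]; _∷_)
open import Data.List using (length; filterᵇ; tabulate)
open import Data.Product using (∃; _×_; _,_; proj₁; proj₂)
open import Data.Sum using (_⊎_; inj₁; inj₂; swap)
open import Data.Empty using (⊥-elim)
open import Function using (Equivalence; id)
open import Relation.Nullary using (yes; no; does; contradiction)
open import Relation.Binary.PropositionalEquality using (_≡_; refl; trans; cong; cong₂; module ≡-Reasoning)
import Relation.Binary.PropositionalEquality as ≡
open import Relation.Binary.Construct.Closure.ReflexiveTransitive using (Star; ε; _◅_; gmap)
open import Algebra.Properties.CommutativeSemigroup *-commutativeSemigroup
  using (interchange; x∙yz≈y∙xz)
open import Algebra.Properties.Semiring.Sum +-*-semiring
  using (sum; sum-syntax; sum-cong-≗; ∑-comm; *-distribˡ-sum; *-distribʳ-sum)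
open import Algebra.Properties.Monoid.Sum *-1-monoid
  using () renaming (sum to product; sum-cong-≗ to product-cong-≗)

-- Partial sums of the exponential series

^-distribʳ-* : ∀ m n o → (m * n) ^ o ≡ m ^ o * n ^ o
^-distribʳ-* m n zero    = refl
^-distribʳ-* m n (suc o) = begin
  m * n * (m * n) ^ o      ≡⟨ cong (m * n *_) (^-distribʳ-* m n o) ⟩
  m * n * (m ^ o * n ^ o)  ≡⟨ interchange m n (m ^ o) (n ^ o) ⟩
  m * m ^ o * (n * n ^ o)  ∎
  where open ≡-Reasoning

-- k! d^k ∑_{i ≤ k} (N/d)^i / i!
expPartial : ℕ → ℕ → ℕ → ℕ
expPartial d N zero    = 1
expPartial d N (suc k) = suc k * d * expPartial d N k + N ^ suc k

ExpNum-scale : ∀ d ℓ k → ExpNum ℓ k * d ^ k ≡ expPartial d (d * ℓ) k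
ExpNum-scale d ℓ zero    = refl
ExpNum-scale d ℓ (suc k) = begin
  (suc k * ExpNum ℓ k + ℓ * ℓ ^ k) * (d * d ^ k)
    ≡⟨ distribute (suc k) (ExpNum ℓ k) ℓ (ℓ ^ k) d (d ^ k) ⟩
  suc k * d * (ExpNum ℓ k * d ^ k) + d * ℓ * (d ^ k * ℓ ^ k)
    ≡⟨ cong₂ (λ a b → suc k * d * a + d * ℓ * b) (ExpNum-scale d ℓ k) (≡.sym (^-distribʳ-* d ℓ k)) ⟩
  suc k * d * expPartial d (d * ℓ) k + d * ℓ * (d * ℓ) ^ k  ∎
  where
  open ≡-Reasoning
  distribute : ∀ s e l L d D → (s * e + l * L) * (d * D) ≡ s * d * (e * D) + d * l * (D * L)
  distribute = solve-∀

expPartial-zero : ∀ d k → expPartial d 0 k ≡ k ! * d ^ k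
expPartial-zero d zero    = refl
expPartial-zero d (suc k) = begin
  suc k * d * expPartial d 0 k + 0  ≡⟨ +-identityʳ _ ⟩
  suc k * d * expPartial d 0 k      ≡⟨ cong (suc k * d *_) (expPartial-zero d k) ⟩
  suc k * d * (k ! * d ^ k)         ≡⟨ interchange (suc k) d (k !) (d ^ k) ⟩
  suc k ! * d ^ suc k               ∎
  where open ≡-Reasoning

suc-^-suc-≤ : ∀ N j → suc N ^ suc j ≤ N ^ suc j + suc j * suc N ^ j
suc-^-suc-≤ N zero    = ≤-reflexive (+-comm 1 (N * 1))
suc-^-suc-≤ N (suc j) = begin
  suc N * suc N ^ suc j
    ≤⟨ *-monoʳ-≤ (suc N) (suc-^-suc-≤ N j) ⟩
  suc N * (N ^ suc j + suc j * suc N ^ j)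
    ≡⟨ expand N (N ^ suc j) (suc j) (suc N ^ j) ⟩
  N * N ^ suc j + (N ^ suc j + suc j * (suc N * suc N ^ j))
    ≤⟨ +-monoʳ-≤ (N * N ^ suc j) (+-monoˡ-≤ _ (^-monoˡ-≤ (suc j) (n≤1+n N))) ⟩
  N ^ suc (suc j) + suc (suc j) * suc N ^ suc j  ∎
  where
  open ≤-Reasoning
  expand : ∀ N P j Q → suc N * (P + j * Q) ≡ N * P + (P + j * (suc N * Q))
  expand = solve-∀

-- A discrete mean value inequality: P_{k+1}(x + 1/d) ≤ P_{k+1}(x) + P_k(x + 1/d) / d
-- for the partial sums P_k of the exponential series.
expPartial-mean-value : ∀ d N k →
  expPartial d (suc N) (suc k) ≤ expPartial d N (suc k) + suc k * expPartial d (suc N) k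
expPartial-mean-value d N zero = ≤-reflexive (base d N)
  where
  base : ∀ d N → 1 * d * 1 + suc N * 1 ≡ (1 * d * 1 + N * 1) + 1 * 1
  base = solve-∀
expPartial-mean-value d N (suc k) = begin
  s * d * expPartial d (suc N) (suc k) + suc N ^ s
    ≤⟨ +-mono-≤ (*-monoʳ-≤ (s * d) (expPartial-mean-value d N k)) (suc-^-suc-≤ N (suc k)) ⟩
  s * d * (expPartial d N (suc k) + suc k * expPartial d (suc N) k) + (N ^ s + s * suc N ^ suc k)
    ≡⟨ regroup s d (expPartial d N (suc k)) (suc k) (expPartial d (suc N) k) (N ^ s) (suc N ^ suc k) ⟩
  expPartial d N s + s * expPartial d (suc N) (suc k)  ∎
  where
  open ≤-Reasoning
  s = suc (suc k)
  regroup : ∀ s d A t B P Q → s * d * (A + t * B) + (P + s * Q) ≡ (s * d * A + P) + s * (t * d * B + Q)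
  regroup = solve-∀

-- The partial sums of e^(N/d) are bounded by (d/m)^N, where d = m + 1.
expPartial-bound : ∀ m N k → expPartial (suc m) N k * m ^ N ≤ k ! * suc m ^ (N + k)
expPartial-bound m zero k = ≤-reflexive (trans (*-identityʳ _) (expPartial-zero (suc m) k))
expPartial-bound m (suc N) zero = begin
  1 * m ^ suc N                ≡⟨ *-identityˡ _ ⟩
  m ^ suc N                    ≤⟨ ^-monoˡ-≤ (suc N) (n≤1+n m) ⟩
  suc m ^ suc N                ≡⟨ cong (suc m ^_) (≡.sym (+-identityʳ (suc N))) ⟩
  suc m ^ (suc N + 0)          ≡⟨ ≡.sym (*-identityˡ _) ⟩
  1 * suc m ^ (suc N + 0)      ∎
  where open ≤-Reasoning
expPartial-bound m (suc N) (suc k) = begin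
  expPartial d (suc N) (suc k) * (m * m ^ N)
    ≤⟨ *-monoˡ-≤ (m * m ^ N) (expPartial-mean-value d N k) ⟩
  (expPartial d N (suc k) + suc k * expPartial d (suc N) k) * (m * m ^ N)
    ≡⟨ distribute (expPartial d N (suc k)) (suc k) (expPartial d (suc N) k) m (m ^ N) ⟩
  m * (expPartial d N (suc k) * m ^ N) + suc k * (expPartial d (suc N) k * (m * m ^ N))
    ≤⟨ +-mono-≤ (*-monoʳ-≤ m (expPartial-bound m N (suc k)))
                (*-monoʳ-≤ (suc k) (expPartial-bound m (suc N) k)) ⟩
  m * (suc k ! * d ^ (N + suc k)) + suc k * (k ! * d ^ suc (N + k))
    ≡⟨ cong (λ e → m * (suc k ! * d ^ (N + suc k)) + suc k * (k ! * d ^ e)) (≡.sym (+-suc N k)) ⟩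
  m * (suc k ! * d ^ (N + suc k)) + suc k * (k ! * d ^ (N + suc k))
    ≡⟨ collect m (suc k) (k !) (d ^ (N + suc k)) ⟩
  suc k ! * d ^ (suc N + suc k)  ∎
  where
  open ≤-Reasoning
  d = suc m
  distribute : ∀ A s B m M → (A + s * B) * (m * M) ≡ m * (A * M) + s * (B * (m * M))
  distribute = solve-∀
  collect : ∀ m s f X → m * ((s * f) * X) + s * (f * X) ≡ (s * f) * (suc m * X)
  collect = solve-∀

-- e^ℓ ≤ (1 + 1/m)^((m+1)ℓ)
≤exp⇒*^≤^ : ∀ m ℓ {x} → x ≤exp ℓ → x * m ^ (suc m * ℓ) ≤ suc m ^ (suc m * ℓ)
≤exp⇒*^≤^ m ℓ {x} (k , x*k!≤) = *-cancelʳ-≤ _ _ (k ! * d ^ k) {{k!d^k≢0}} (begin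
  x * m ^ N * (k ! * d ^ k)    ≡⟨ rearrange x (m ^ N) (k !) (d ^ k) ⟩
  x * k ! * d ^ k * m ^ N      ≤⟨ *-monoˡ-≤ (m ^ N) (*-monoˡ-≤ (d ^ k) x*k!≤) ⟩
  ExpNum ℓ k * d ^ k * m ^ N   ≡⟨ cong (_* m ^ N) (ExpNum-scale d ℓ k) ⟩
  expPartial d N k * m ^ N     ≤⟨ expPartial-bound m N k ⟩
  k ! * d ^ (N + k)            ≡⟨ cong (k ! *_) (^-distribˡ-+-* d N k) ⟩
  k ! * (d ^ N * d ^ k)        ≡⟨ x∙yz≈y∙xz (k !) (d ^ N) (d ^ k) ⟩
  d ^ N * (k ! * d ^ k)        ∎)
  where
  open ≤-Reasoning
  d = suc m
  N = d * ℓ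
  k!d^k≢0 : NonZero (k ! * d ^ k)
  k!d^k≢0 = >-nonZero (*-mono-≤ (1≤n! k) (m^n>0 d k))
  rearrange : ∀ x M a b → x * M * (a * b) ≡ x * a * b * M
  rearrange = solve-∀

-- The parameters n, ℓ, d

ExpNum-zeroˡ : ∀ k → ExpNum 0 k ≡ k !
ExpNum-zeroˡ zero    = refl
ExpNum-zeroˡ (suc k) = trans (+-identityʳ _) (cong (suc k *_) (ExpNum-zeroˡ k))

≤exp-zero⇒≤1 : ∀ {x} → x ≤exp 0 → x ≤ 1
≤exp-zero⇒≤1 (k , x*k!≤) = *-cancelʳ-≤ _ 1 (k !) {{k !≢0}}
  (≤-trans x*k!≤ (≤-reflexive (trans (ExpNum-zeroˡ k) (≡.sym (*-identityˡ (k !))))))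

^≤exp-zero : ∀ {n} k → n ^ 3 ≤exp 0 → n ^ k ≤exp 0
^≤exp-zero {n} k n³≤exp0 = 0 , (begin
  n ^ k * 1   ≡⟨ *-identityʳ _ ⟩
  n ^ k       ≤⟨ ^-monoˡ-≤ k n≤1 ⟩
  1 ^ k       ≡⟨ ^-zeroˡ k ⟩
  1           ∎)
  where
  open ≤-Reasoning
  n≤1 : n ≤ 1
  n≤1 = ≮⇒≥ λ 1<n → <⇒≱ (^-monoˡ-< 3 1<n) (≤exp-zero⇒≤1 n³≤exp0)

≤exp⇒≤4^ : ∀ {x} ℓ → x ≤exp ℓ → x ≤ 4 ^ ℓ
≤exp⇒≤4^ {x} ℓ x≤expℓ = begin
  x                  ≡⟨ ≡.sym (*-identityʳ x) ⟩
  x * 1              ≡⟨ cong (x *_) (≡.sym (^-zeroˡ (2 * ℓ))) ⟩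
  x * 1 ^ (2 * ℓ)    ≤⟨ ≤exp⇒*^≤^ 1 ℓ {x} x≤expℓ ⟩
  2 ^ (2 * ℓ)        ≡⟨ ≡.sym (^-*-assoc 2 2 ℓ) ⟩
  4 ^ ℓ              ∎
  where open ≤-Reasoning

colours<vertices : ∀ {n ℓ d} → 2 ≤ n → ℓ < n → n ^ (3 * d) ≤exp ℓ → d < n
colours<vertices {n} {ℓ} {d} 2≤n ℓ<n n³ᵈ≤expℓ = ≰⇒> λ n≤d → <-irrefl refl (begin-strict
  n ^ (3 * n)   ≤⟨ ^-monoʳ-≤ n {{>-nonZero (≤-trans (s≤s z≤n) 2≤n)}} (*-monoʳ-≤ 3 n≤d) ⟩
  n ^ (3 * d)   ≤⟨ ≤exp⇒≤4^ ℓ n³ᵈ≤expℓ ⟩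
  4 ^ ℓ         <⟨ ^-monoʳ-< 4 (s≤s (s≤s z≤n)) ℓ<n ⟩
  4 ^ n         ≤⟨ ^-monoˡ-≤ n (≤-trans (m≤n+m 4 4) (^-monoˡ-≤ 3 2≤n)) ⟩
  (n ^ 3) ^ n   ≡⟨ ^-*-assoc n 3 n ⟩
  n ^ (3 * n)   ∎)
  where open ≤-Reasoning

≤exp⇒cube*^≤^ : ∀ {n ℓ m} → n ^ (3 * suc m) ≤exp ℓ → n ^ 3 * m ^ ℓ ≤ suc m ^ ℓ
≤exp⇒cube*^≤^ {n} {ℓ} {m} n³ᵈ≤expℓ = ≮⇒≥ λ d^ℓ<n³m^ℓ → <⇒≱ (^-monoˡ-< d d^ℓ<n³m^ℓ) (begin
  (n ^ 3 * m ^ ℓ) ^ d        ≡⟨ ^-distribʳ-* (n ^ 3) (m ^ ℓ) d ⟩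
  (n ^ 3) ^ d * (m ^ ℓ) ^ d  ≡⟨ cong₂ _*_ (^-*-assoc n 3 d) (trans (^-*-assoc m ℓ d) (cong (m ^_) (*-comm ℓ d))) ⟩
  n ^ (3 * d) * m ^ (d * ℓ)  ≤⟨ ≤exp⇒*^≤^ m ℓ {n ^ (3 * d)} n³ᵈ≤expℓ ⟩
  d ^ (d * ℓ)                ≡⟨ ≡.sym (trans (^-*-assoc d ℓ d) (cong (d ^_) (*-comm ℓ d))) ⟩
  (d ^ ℓ) ^ d                ∎)
  where
  open ≤-Reasoning
  d = suc m

-- n² d (1 − 1/d)^ℓ < 1, the union bound over pairs of vertices and colours.
unionBound<1 : ∀ {n ℓ m} → 0 < ℓ → ℓ < n → n ^ (3 * suc m) ≤exp ℓ → n * n * suc m * m ^ ℓ < suc m ^ ℓ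
unionBound<1 {n} {suc ℓ} {zero} _ _ _ = begin-strict
  n * n * 1 * 0   ≡⟨ *-zeroʳ (n * n * 1) ⟩
  0               <⟨ s≤s z≤n ⟩
  1               ≡⟨ ≡.sym (^-zeroˡ (suc ℓ)) ⟩
  1 ^ suc ℓ       ∎
  where open ≤-Reasoning
unionBound<1 {n} {ℓ} {m@(suc _)} 0<ℓ ℓ<n n³ᵈ≤expℓ = begin-strict
  n * n * suc m * m ^ ℓ   <⟨ *-monoˡ-< (m ^ ℓ) (*-monoʳ-< (n * n) d<n) ⟩
  n * n * n * m ^ ℓ       ≡⟨ cong (_* m ^ ℓ) (trans (*-assoc n n n) (cong (λ k → n * (n * k)) (≡.sym (*-identityʳ n)))) ⟩
  n ^ 3 * m ^ ℓ           ≤⟨ ≤exp⇒cube*^≤^ {n} n³ᵈ≤expℓ ⟩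
  suc m ^ ℓ               ∎
  where
  open ≤-Reasoning
  2≤n = ≤-trans (s≤s 0<ℓ) ℓ<n
  1≤n = ≤-trans (s≤s z≤n) 2≤n
  d<n = colours<vertices 2≤n ℓ<n n³ᵈ≤expℓ
  instance
    n*n≢0 : NonZero (n * n)
    n*n≢0 = >-nonZero (*-mono-≤ 1≤n 1≤n)
    m^ℓ≢0 : NonZero (m ^ ℓ)
    m^ℓ≢0 = m^n≢0 m ℓ

-- Sums over colourings

∑-const : ∀ n c → ∑[ i < n ] c ≡ n * c
∑-const zero    c = refl
∑-const (suc n) c = cong (c +_) (∑-const n c)

∑-mono-≤ : ∀ {n} {f g : Fin n → ℕ} → (∀ i → f i ≤ g i) → sum f ≤ sum g
∑-mono-≤ {zero}  f≤g = z≤n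
∑-mono-≤ {suc n} f≤g = +-mono-≤ (f≤g zero) (∑-mono-≤ (λ i → f≤g (suc i)))

≤-∑ : ∀ {n} (f : Fin n → ℕ) i → f i ≤ sum f
≤-∑ f zero    = m≤m+n _ _
≤-∑ f (suc i) = ≤-trans (≤-∑ (λ j → f (suc j)) i) (m≤n+m _ _)

∑-<⇒ : ∀ {n} (f g : Fin n → ℕ) → sum f < sum g → ∃ λ i → f i < g i
∑-<⇒ {suc n} f g ∑f<∑g with f zero <? g zero
... | yes f₀<g₀ = zero , f₀<g₀
... | no  f₀≮g₀ with ∑-<⇒ (λ i → f (suc i)) (λ i → g (suc i))
                       (+-cancelˡ-< (g zero) _ _ (≤-<-trans (+-monoˡ-≤ _ (≮⇒≥ f₀≮g₀)) ∑f<∑g))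
...   | i , fᵢ<gᵢ = suc i , fᵢ<gᵢ

product≡0⇒ : ∀ {n} (f : Fin n → ℕ) → product f ≡ 0 → ∃ λ i → f i ≡ 0
product≡0⇒ {suc n} f ∏f≡0 with m*n≡0⇒m≡0∨n≡0 (f zero) ∏f≡0
... | inj₁ f₀≡0 = zero , f₀≡0
... | inj₂ ∏≡0 with product≡0⇒ (λ i → f (suc i)) ∏≡0
...   | i , fᵢ≡0 = suc i , fᵢ≡0

∑ᶠ : ∀ {d} n → ((Fin n → Fin d) → ℕ) → ℕ
∑ᶠ     zero    F = F []
∑ᶠ {d} (suc n) F = ∑[ x < d ] ∑ᶠ n (λ f → F (x ∷ f))

∑ᶠ-*ˡ : ∀ {d} n c (F : (Fin n → Fin d) → ℕ) → ∑ᶠ n (λ f → c * F f) ≡ c * ∑ᶠ n F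
∑ᶠ-*ˡ zero    c F = refl
∑ᶠ-*ˡ {d} (suc n) c F = trans (sum-cong-≗ {d} λ x → ∑ᶠ-*ˡ n c _) (≡.sym (*-distribˡ-sum {d} c _))

∑ᶠ-∑-comm : ∀ {d} n {k} (H : Fin k → (Fin n → Fin d) → ℕ) →
  ∑ᶠ n (λ f → ∑[ i < k ] H i f) ≡ ∑[ i < k ] ∑ᶠ n (H i)
∑ᶠ-∑-comm zero    H = refl
∑ᶠ-∑-comm {d} (suc n) H = trans (sum-cong-≗ {d} λ x → ∑ᶠ-∑-comm n λ i f → H i (x ∷ f))
                            (∑-comm λ x i → ∑ᶠ n λ f → H i (x ∷ f))

∑ᶠ-one : ∀ {d} n → ∑ᶠ {d} n (λ _ → 1) ≡ d ^ n
∑ᶠ-one {d} zero    = refl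
∑ᶠ-one {d} (suc n) = trans (sum-cong-≗ {d} λ _ → ∑ᶠ-one n) (∑-const d (d ^ n))

∑ᶠ-<⇒ : ∀ {d} n (F G : (Fin n → Fin d) → ℕ) → ∑ᶠ n F < ∑ᶠ n G → ∃ λ f → F f < G f
∑ᶠ-<⇒ zero    F G F[]<G[] = [] , F[]<G[]
∑ᶠ-<⇒ (suc n) F G ∑F<∑G with ∑-<⇒ _ _ ∑F<∑G
... | x , ∑Fₓ<∑Gₓ with ∑ᶠ-<⇒ n _ _ ∑Fₓ<∑Gₓ
...   | f , Fₓf<Gₓf = x ∷ f , Fₓf<Gₓf

-- Independence of the colours of distinct vertices.
∑ᶠ-product : ∀ {d} n (g : Fin n → Fin d → ℕ) →
  ∑ᶠ n (λ f → product (λ w → g w (f w))) ≡ product (λ w → ∑[ x < d ] g w x)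
∑ᶠ-product zero    g = refl
∑ᶠ-product {d} (suc n) g = begin
  ∑[ x < d ] ∑ᶠ n (λ f → g zero x * product (λ w → g (suc w) (f w)))
    ≡⟨ sum-cong-≗ {d} (λ x → ∑ᶠ-*ˡ n (g zero x) _) ⟩
  ∑[ x < d ] (g zero x * ∑ᶠ n (λ f → product (λ w → g (suc w) (f w))))
    ≡⟨ sum-cong-≗ {d} (λ x → cong (g zero x *_) (∑ᶠ-product n (λ w → g (suc w)))) ⟩
  ∑[ x < d ] (g zero x * product (λ w → ∑[ x < d ] g (suc w) x))
    ≡⟨ ≡.sym (*-distribʳ-sum _ (g zero)) ⟩
  (∑[ x < d ] g zero x) * product (λ w → ∑[ x < d ] g (suc w) x)  ∎
  where open ≡-Reasoning

∑ᶠ-∑-≤ : ∀ {d} n {k} c B (H : Fin k → (Fin n → Fin d) → ℕ) → (∀ i → ∑ᶠ n (H i) * c ≤ B) →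
  ∑ᶠ n (λ f → ∑[ i < k ] H i f) * c ≤ k * B
∑ᶠ-∑-≤ n {k} c B H bound = begin
  ∑ᶠ n (λ f → ∑[ i < k ] H i f) * c  ≡⟨ cong (_* c) (∑ᶠ-∑-comm n H) ⟩
  (∑[ i < k ] ∑ᶠ n (H i)) * c        ≡⟨ *-distribʳ-sum {k} c _ ⟩
  ∑[ i < k ] (∑ᶠ n (H i) * c)        ≤⟨ ∑-mono-≤ {k} bound ⟩
  ∑[ i < k ] B                       ≡⟨ ∑-const k B ⟩
  k * B                              ∎
  where open ≤-Reasoning

-- Strong rigid partitions from colourings

CommonNbrsSeeAllColours : ∀ {n d} → Graph n → (Fin n → Fin d) → Set
CommonNbrsSeeAllColours {n} {d} G f =
  ∀ (u v : Fin n) → u ≢ v → ∀ (c : Fin d) → ∃ λ w → T (adj G u w) × T (adj G w v) × f w ≡ c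

adj⇒≢ : ∀ {n} (G : Graph n) {x y} → T (adj G x y) → x ≢ y
adj⇒≢ G {x} xy refl rewrite irrefl G x = xy

BipEdge-swap : ∀ {n} (G : Graph n) {A B x y} → BipEdge G A B x y → BipEdge G B A x y
BipEdge-swap G (xy , x∈A⊎B) = xy , swap x∈A⊎B

module _ {n d} (G : Graph n) {f : Fin n → Fin d} (see : CommonNbrsSeeAllColours G f) where

  private
    Class : Fin d → Fin n → Set
    Class i v = f v ≡ i

  -- Walks of length 2 (y in the class of x) or 3 (y in the other class), through common neighbours.
  walk : ∀ i j {x y} → f x ≡ i → f y ≡ i ⊎ f y ≡ j → x ≢ y → Star (BipEdge G (Class i) (Class j)) x y
  walk i j {x} {y} fx (inj₁ fy) x≢y with see x y x≢y j
  ... | w , xw , wy , fw = (xw , inj₁ (fx , fw)) ◅ (wy , inj₂ (fw , fy)) ◅ ε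
  walk i j {x} {y} fx (inj₂ fy) x≢y with see x y x≢y i
  ... | z , xz , zy , fz with see x z (adj⇒≢ G xz) j
  ...   | w , xw , wz , fw = (xw , inj₁ (fx , fw)) ◅ (wz , inj₂ (fw , fz)) ◅ (zy , inj₁ (fz , fy)) ◅ ε

  classes-connected : ∀ i j → ConnectedBetween G (Class i) (Class j)
  classes-connected i j x y x∈ y∈ with x ≟ y
  classes-connected i j x y x∈       y∈ | yes refl = ε
  classes-connected i j x y (inj₁ fx) y∈ | no x≢y = walk i j fx y∈ x≢y
  classes-connected i j x y (inj₂ fx) y∈ | no x≢y = gmap id (BipEdge-swap G) (walk j i fx (swap y∈) x≢y)

  strongRigidPartition : ∀ {u v : Fin n} → u ≢ v → StrongRigidPartition G d
  strongRigidPartition {u} {v} u≢v = f , surjective , classes-connected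
    where
    surjective : ∀ c → ∃ λ x → ∀ {z} → z ≡ x → f z ≡ c
    surjective c with see u v u≢v c
    ... | w , _ , _ , fw = w , λ { refl → fw }

-- Existence of a good colouring

∑-≢ : ∀ {m} (c : Fin (suc m)) → ∑[ x < suc m ] (if does (x ≟ c) then 0 else 1) ≡ m
∑-≢ {m}     zero    = trans (∑-const m 1) (*-identityʳ m)
∑-≢ {suc m} (suc c) = cong suc (∑-≢ c)

avoids : ∀ {d} → Bool → Fin d → Fin d → ℕ
avoids b c x = if b ∧ does (x ≟ c) then 0 else 1

∑-avoids : ∀ {m} b (c : Fin (suc m)) → ∑[ x < suc m ] avoids b c x ≡ (if b then m else suc m)
∑-avoids true  c = ∑-≢ c
∑-avoids {m} false c = trans (∑-const (suc m) 1) (*-identityʳ (suc m))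

avoids≡0⇒ : ∀ {d} b (c x : Fin d) → avoids b c x ≡ 0 → T b × x ≡ c
avoids≡0⇒ true c x eq with x ≟ c
avoids≡0⇒ true c x eq | yes x≡c = _ , x≡c
avoids≡0⇒ true c x () | no _
avoids≡0⇒ false c x ()

module _ {A : Set} (m : ℕ) (S : A → Bool) where

  private
    d = suc m

  ∏-if : ∀ {n} → (Fin n → A) → ℕ
  ∏-if g = product (λ w → if S (g w) then m else d)

  ∏-if-bound : ∀ {n} ℓ (g : Fin n → A) → ℓ ≤ length (filterᵇ S (tabulate g)) →
    ∏-if g * d ^ ℓ ≤ m ^ ℓ * d ^ n
  ∏-if-bound {zero}  zero g z≤n = ≤-refl
  ∏-if-bound {suc n} ℓ    g ℓ≤ with S (g zero) | ℓ | ℓ≤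
  ... | true | zero | _ = begin
    m * ∏-if g′ * 1          ≡⟨ *-assoc m (∏-if g′) 1 ⟩
    m * (∏-if g′ * 1)        ≤⟨ *-monoˡ-≤ (∏-if g′ * 1) (n≤1+n m) ⟩
    d * (∏-if g′ * 1)        ≤⟨ *-monoʳ-≤ d (∏-if-bound 0 g′ z≤n) ⟩
    d * (1 * d ^ n)          ≡⟨ x∙yz≈y∙xz d 1 (d ^ n) ⟩
    1 * (d * d ^ n)          ∎
    where
    open ≤-Reasoning
    g′ = λ w → g (suc w)
  ... | true | suc ℓ′ | s≤s ℓ′≤ = begin
    m * ∏-if g′ * (d * d ^ ℓ′)   ≡⟨ interchange m (∏-if g′) d (d ^ ℓ′) ⟩
    m * d * (∏-if g′ * d ^ ℓ′)   ≤⟨ *-monoʳ-≤ (m * d) (∏-if-bound ℓ′ g′ ℓ′≤) ⟩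
    m * d * (m ^ ℓ′ * d ^ n)     ≡⟨ interchange m d (m ^ ℓ′) (d ^ n) ⟩
    m * m ^ ℓ′ * (d * d ^ n)     ∎
    where
    open ≤-Reasoning
    g′ = λ w → g (suc w)
  ... | false | ℓ′ | ℓ′≤ = begin
    d * ∏-if g′ * d ^ ℓ′         ≡⟨ *-assoc d (∏-if g′) (d ^ ℓ′) ⟩
    d * (∏-if g′ * d ^ ℓ′)       ≤⟨ *-monoʳ-≤ d (∏-if-bound ℓ′ g′ ℓ′≤) ⟩
    d * (m ^ ℓ′ * d ^ n)         ≡⟨ x∙yz≈y∙xz d (m ^ ℓ′) (d ^ n) ⟩
    m ^ ℓ′ * (d * d ^ n)         ∎
    where
    open ≤-Reasoning
    g′ = λ w → g (suc w)

module _ {n m : ℕ} (G : Graph n) where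

  private
    d = suc m

  common : Fin n → Fin n → Fin n → Bool
  common u v w = adj G u w ∧ adj G w v

  -- The indicator that u ≠ v and no common neighbour of u and v has colour c.
  Missing : (Fin n → Fin d) → Fin n → Fin n → Fin d → ℕ
  Missing f u v c = (if does (u ≟ v) then 0 else 1) * product (λ w → avoids (common u v w) c (f w))

  ∑ᶠ-Missing : ∀ u v c → ∑ᶠ n (λ f → Missing f u v c) ≡
    (if does (u ≟ v) then 0 else 1) * ∏-if m (common u v) id
  ∑ᶠ-Missing u v c = begin
    ∑ᶠ n (λ f → [u≢v] * product (λ w → avoids (common u v w) c (f w)))
      ≡⟨ ∑ᶠ-*ˡ n [u≢v] _ ⟩
    [u≢v] * ∑ᶠ n (λ f → product (λ w → avoids (common u v w) c (f w)))
      ≡⟨ cong ([u≢v] *_) (∑ᶠ-product n (λ w → avoids (common u v w) c)) ⟩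
    [u≢v] * product (λ w → ∑[ x < d ] avoids (common u v w) c x)
      ≡⟨ cong ([u≢v] *_) (product-cong-≗ {n} (λ w → ∑-avoids (common u v w) c)) ⟩
    [u≢v] * ∏-if m (common u v) id  ∎
    where
    open ≡-Reasoning
    [u≢v] = if does (u ≟ v) then 0 else 1

  module _ {ℓ : ℕ} (ℓ≤common : ∀ (u v : Fin n) → u ≢ v → ℓ ≤ commonNbrs G u v) where

    ∑ᶠ-Missing-bound : ∀ u v c → ∑ᶠ n (λ f → Missing f u v c) * d ^ ℓ ≤ m ^ ℓ * d ^ n
    ∑ᶠ-Missing-bound u v c rewrite ∑ᶠ-Missing u v c with u ≟ v
    ... | yes _   = z≤n
    ... | no u≢v  = begin
      1 * ∏-if m (common u v) id * d ^ ℓ    ≡⟨ cong (_* d ^ ℓ) (*-identityˡ (∏-if m (common u v) id)) ⟩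
      ∏-if m (common u v) id * d ^ ℓ        ≤⟨ ∏-if-bound m (common u v) ℓ id (ℓ≤common u v u≢v) ⟩
      m ^ ℓ * d ^ n                         ∎
      where open ≤-Reasoning

    Bad : (Fin n → Fin d) → ℕ
    Bad f = ∑[ u < n ] ∑[ v < n ] ∑[ c < d ] Missing f u v c

    ∑ᶠ-Bad-bound : ∑ᶠ n Bad * d ^ ℓ ≤ n * (n * (d * (m ^ ℓ * d ^ n)))
    ∑ᶠ-Bad-bound =
      ∑ᶠ-∑-≤ n (d ^ ℓ) _ _ λ u →
      ∑ᶠ-∑-≤ n (d ^ ℓ) _ _ λ v →
      ∑ᶠ-∑-≤ n (d ^ ℓ) _ _ λ c → ∑ᶠ-Missing-bound u v c

    Missing≡0 : ∀ f → Bad f ≡ 0 → ∀ u v c → Missing f u v c ≡ 0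
    Missing≡0 f Bad≡0 u v c = n≤0⇒n≡0 (begin
      Missing f u v c                               ≤⟨ ≤-∑ (Missing f u v) c ⟩
      ∑[ c < d ] Missing f u v c                    ≤⟨ ≤-∑ (λ v → ∑[ c < d ] Missing f u v c) v ⟩
      ∑[ v < n ] ∑[ c < d ] Missing f u v c         ≤⟨ ≤-∑ (λ u → ∑[ v < n ] ∑[ c < d ] Missing f u v c) u ⟩
      Bad f                                         ≡⟨ Bad≡0 ⟩
      0                                             ∎)
      where open ≤-Reasoning

    Missing≡0⇒seen : ∀ f u v c → u ≢ v → Missing f u v c ≡ 0 →
      ∃ λ w → T (adj G u w) × T (adj G w v) × f w ≡ c
    Missing≡0⇒seen f u v c u≢v M≡0 with u ≟ v
    ... | yes u≡v = contradiction u≡v u≢v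
    ... | no _ with product≡0⇒ _ (trans (≡.sym (+-identityʳ _)) M≡0)
    ...   | w , avoids≡0 with avoids≡0⇒ (common u v w) c (f w) avoids≡0
    ...     | uwv , fw≡c = w , proj₁ (Equivalence.to T-∧ uwv) , proj₂ (Equivalence.to T-∧ uwv) , fw≡c

    -- The probabilistic method: fewer than d^n pairs (f, bad event) exist, so some f has none.
    seeAllColours : n * n * d * m ^ ℓ < d ^ ℓ → ∃ λ f → CommonNbrsSeeAllColours G f
    seeAllColours key with ∑ᶠ-<⇒ n Bad (λ _ → 1) ∑ᶠBad<dⁿ
      where
      ∑ᶠBad<dⁿ : ∑ᶠ n Bad < ∑ᶠ n (λ _ → 1)
      ∑ᶠBad<dⁿ = *-cancelʳ-< (d ^ ℓ) _ _ (begin-strict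
        ∑ᶠ n Bad * d ^ ℓ                  ≤⟨ ∑ᶠ-Bad-bound ⟩
        n * (n * (d * (m ^ ℓ * d ^ n)))   ≡⟨ reassoc n d (m ^ ℓ) (d ^ n) ⟩
        n * n * d * m ^ ℓ * d ^ n         <⟨ *-monoˡ-< (d ^ n) {{m^n≢0 d n}} key ⟩
        d ^ ℓ * d ^ n                     ≡⟨ *-comm (d ^ ℓ) (d ^ n) ⟩
        d ^ n * d ^ ℓ                     ≡⟨ cong (_* d ^ ℓ) (≡.sym (∑ᶠ-one n)) ⟩
        ∑ᶠ n (λ _ → 1) * d ^ ℓ            ∎)
        where
        open ≤-Reasoning
        reassoc : ∀ n d a b → n * (n * (d * (a * b))) ≡ n * n * d * a * b
        reassoc = solve-∀
    ... | f , Bad<1 = f , λ u v u≢v c → Missing≡0⇒seen f u v c u≢v (Missing≡0 f (n<1⇒n≡0 Bad<1) u v c)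

theorem5p1 : (n ℓ : ℕ) (G : Graph n)
    → n ^ 3 ≤exp ℓ
    → ℓ < n
    → (∀ (u v : Fin n) → u ≢ v → ℓ ≤ commonNbrs G u v)
    → (d : ℕ)
    → n ^ (3 * d) ≤exp ℓ
    → ¬ (n ^ (3 * suc d) ≤exp ℓ)
    → StrongRigidPartition G d
theorem5p1 n ℓ G n³≤expℓ ℓ<n ℓ≤common zero n³ᵈ≤expℓ n³⁽ᵈ⁺¹⁾≰expℓ = ⊥-elim (n³⁽ᵈ⁺¹⁾≰expℓ n³≤expℓ)
theorem5p1 n zero G n³≤exp0 ℓ<n ℓ≤common (suc m) n³ᵈ≤exp0 n³⁽ᵈ⁺¹⁾≰exp0 =
  ⊥-elim (n³⁽ᵈ⁺¹⁾≰exp0 (^≤exp-zero {n} (3 * suc (suc m)) n³≤exp0))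
theorem5p1 (suc (suc n)) (suc ℓ) G _ ℓ<n@(s≤s (s≤s _)) ℓ≤common (suc m) n³ᵈ≤expℓ _ =
  strongRigidPartition G seesAll {zero} {suc zero} (λ ())
  where
  seesAll = proj₂ (seeAllColours G ℓ≤common (unionBound<1 (s≤s z≤n) ℓ<n n³ᵈ≤expℓ))
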